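{- Let $D'$ be the planar network described below. Fix integers $n\ge k\ge0$ and let $\mathbf{w}$ be a finite word in the alphabet $\mathcal{A}\cup\mathcal{E}$. Then $\mathbf{w}=\mathrm{wt}(\mathcal{P})$ for some path $\mathcal{P}\in\mathsf{P}_{n,k}$ if and only if all of the following hold: (i) the first letter of $\mathbf{w}$ is either $e_{n-1,0}$ or $a_{n-1,j,0}$ for some $0\le j\le n-1$; (ii) the last letter of $\mathbf{w}$ is either $e_{0,k}$ or $a_{0,0,k-1}$; (iii) the letter following any occurrence of $a_{i,j,l}$ is either $e_{i-1,l+1}$ or $a_{i-1,j',l+1}$ for some $j\le j'\le i-1$; (iv) the letter following any occurrence of $e_{i,l}$ is either $e_{i-1,l}$ or $a_{i-1,j,l}$ for some $0\le j\le i-1$. Furthermore, in this case $\mathbf{w}$ has length $n$ and the path $\mathcal{P}$ is unique.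
   Context: Let $\Delta(n)=\binom{n+1}{2}$ for $n\ge0$ (triangular numbers); for a triangular number $t$, $\Delta^{ -1}(t)$ is the unique $n\ge0$ with $\Delta(n)=t$. For an integer $m\ge0$, let $\lceil m\rceil_\Delta$ be the smallest triangular number $\ge m$ and $\delta(m)=\lceil m\rceil_\Delta-m$. Let $\mathcal{A}=\{a_{i,j,l}:(i,j,l)\in\mathbb{N}^3,\ j\le i\}$ and $\mathcal{E}=\{e_{i,l}:(i,l)\in\mathbb{N}^2\}$ be sets of symbols. Consider the digraph with vertex set $\{(i,j)\in\mathbb{Z}^2:0\le i\le j\}$ where, for $1\le i\le j$, there is a horizontal edge $(i,j)\to(i-1,j)$ of weight $\alpha_{i,j-i+1}$ and a diagonal edge $(i,j)\to(i-1,j-1)$ of weight $\beta_{i,j-i}$. Here, for $i\ge1,l\ge0$: $\beta_{i,l}=e_{\Delta^{ -1}(i+l-1)-l,\,l}$ if $i+l-1$ is triangular and $i+l-1\ge\Delta(l)$; $\beta_{i,l}=1$ if $i+l-1$ is not triangular and $i+l-1\ge\Delta(l)$; $\beta_{i,l}=0$ otherwise. For $i,l\ge1$: $\alpha_{i,l}=a_{\Delta^{ -1}(\lceil i+l-1\rceil_\Delta)-l,\ \delta(i+l-1),\ l-1}$ if $\Delta^{ -1}(\lceil i+l-1\rceil_\Delta)-l\ge\delta(i+l-1)$; otherwise $\alpha_{i,l}=1$ if $i+l-1$ is triangular and $i+l-1<\Delta(l)$; and $\alpha_{i,l}=0$ in all other cases. Deleting all edges of weight $0$ gives $D'$. Edges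 of weight $1$ are called black, the others (with weight in $\mathcal{A}\cup\mathcal{E}$) coloured. Sources are $u_n=(\Delta(n),\Delta(n))$ and sinks $v_k=(0,\Delta(k))$; $\mathsf{P}_{n,k}$ is the set of directed paths in $D'$ from $u_n$ to $v_k$. For a path $\mathcal{P}$, $\mathrm{wt}(\mathcal{P})$ is the non-commutative product (word) of the weights of its edges taken in the order of traversal, black edges contributing nothing; thus it is the word of coloured-edge labels in order. -}

module Defs where

open import Data.Bool using (Bool; true; false; if_then_else_; _∧_; T)
open import Data.Nat using (ℕ; zero; suc; _+_; _∸_; _≤_; _≤ᵇ_; _<ᵇ_; _≡ᵇ_)
open import Data.List using (List; []; _∷_; _++_; head; last)
open import Data.List.Relation.Unary.Linked using (Linked)
open import Data.Maybe.Relation.Unary.Any using () renaming (Any to MaybeAny)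
open import Data.Product using (_×_)
open import Data.Unit using (⊤)
open import Relation.Binary.PropositionalEquality using (_≡_)

Δ : ℕ → ℕ
Δ zero    = zero
Δ (suc n) = suc n + Δ n

-- ceilIdx m = the least n with m ≤ Δ n, i.e. Δ⁻¹(⌈m⌉_Δ).
-- (Structural: the least index increases by at most one from m to m+1.)
ceilIdx : ℕ → ℕ
ceilIdx zero    = zero
ceilIdx (suc m) = if suc m ≤ᵇ Δ (ceilIdx m) then ceilIdx m else suc (ceilIdx m)

⌈_⌉Δ : ℕ → ℕ
⌈ m ⌉Δ = Δ (ceilIdx m)

δ : ℕ → ℕ
δ m = ⌈ m ⌉Δ ∸ m

-- m is triangular iff it equals ⌈m⌉_Δ; then Δ⁻¹(m) = ceilIdx m
isTri : ℕ → Bool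
isTri m = ⌈ m ⌉Δ ≡ᵇ m

data Letter : Set where
  a : ℕ → ℕ → ℕ → Letter   -- a i j l   (a genuine symbol of 𝒜 needs j ≤ i)
  e : ℕ → ℕ → Letter

ValidLetter : Letter → Set
ValidLetter (a i j l) = j ≤ i
ValidLetter (e i l)   = ⊤

data Wt : Set where
  𝟘 𝟙 : Wt
  col : Letter → Wt

β : ℕ → ℕ → Wt
β zero     l = 𝟘   -- outside the domain i ≥ 1 (never used)
β (suc i') l =
  let t = i' + l in
  if Δ l ≤ᵇ t
    then (if isTri t then col (e (ceilIdx t ∸ l) l) else 𝟙)
    else 𝟘

α : ℕ → ℕ → Wt
α zero     _        = 𝟘   -- outside the domain (never used)
α (suc i') zero     = 𝟘   -- outside the domain (never used)
α (suc i') (suc l') =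
  let l = suc l'
      m = i' + l
      N = ceilIdx m
      d = δ m
  in if l + d ≤ᵇ N              -- Δ⁻¹(⌈m⌉_Δ) - l ≥ δ(m)  (as integers)
       then col (a (N ∸ l) d l')
       else (if isTri m ∧ (m <ᵇ Δ l) then 𝟙 else 𝟘)

-- edges of weight 0 are deleted
nonZero : Wt → Bool
nonZero 𝟘 = false
nonZero _ = true

IsEdge : Wt → Set
IsEdge w = T (nonZero w)

-- Horizontal edge (i+1,j) → (i,j) of weight α_{i+1, j-(i+1)+1}, for i+1 ≤ j;
-- diagonal edge (i+1,j+1) → (i,j) of weight β_{i+1, j-i}, for i ≤ j.

data Path : ℕ → ℕ → ℕ → ℕ → Set where
  stop : ∀ {i j} → Path i j i j
  hor  : ∀ {i j i₀ j₀} → suc i ≤ j → IsEdge (α (suc i) (j ∸ i)) →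
         Path i j i₀ j₀ → Path (suc i) j i₀ j₀
  dia  : ∀ {i j i₀ j₀} → i ≤ j → IsEdge (β (suc i) (j ∸ i)) →
         Path i j i₀ j₀ → Path (suc i) (suc j) i₀ j₀

label : Wt → List Letter
label (col x) = x ∷ []
label _       = []

wt : ∀ {i j i₀ j₀} → Path i j i₀ j₀ → List Letter
wt stop          = []
wt (hor {i} {j} _ _ p) = label (α (suc i) (j ∸ i)) ++ wt p
wt (dia {i} {j} _ _ p) = label (β (suc i) (j ∸ i)) ++ wt p

-- sources u_n = (Δ n, Δ n), sinks v_k = (0, Δ k);  𝖯_{n,k}
𝖯 : ℕ → ℕ → Set
𝖯 n k = Path (Δ n) (Δ n) 0 (Δ k)

data StartLetter (n : ℕ) : Letter → Set where
  start-e : ∀ {i} → suc i ≡ n → StartLetter n (e i 0)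
  start-a : ∀ {i j} → suc i ≡ n → j ≤ i → StartLetter n (a i j 0)

data EndLetter (k : ℕ) : Letter → Set where
  end-e : EndLetter k (e 0 k)
  end-a : ∀ {l} → suc l ≡ k → EndLetter k (a 0 0 l)

-- (iii),(iv): Follows x y  means  y may follow x
data Follows : Letter → Letter → Set where
  a→e : ∀ {i j l} → Follows (a (suc i) j l) (e i (suc l))
  a→a : ∀ {i j j' l} → j ≤ j' → j' ≤ i → Follows (a (suc i) j l) (a i j' (suc l))
  e→e : ∀ {i l} → Follows (e (suc i) l) (e i l)
  e→a : ∀ {i j l} → j ≤ i → Follows (e (suc i) l) (a i j l)

Conditions : ℕ → ℕ → List Letter → Set
Conditions n k w =
  MaybeAny (StartLetter n) (head w) ×
  MaybeAny (EndLetter k) (last w) ×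
  Linked Follows w

{-# OPTIONS --safe #-}
module Submission where

open import Defs
open import Data.Bool using (false)
open import Data.Bool.Properties using (T-irrelevant)
open import Data.Empty using (⊥-elim)
open import Data.List using (List; []; _∷_; _++_; length; last)
open import Data.List.Properties using (++-cancelˡ)
open import Data.List.Relation.Unary.All using (All; _∷_)
open import Data.List.Relation.Unary.Linked using (Linked; [-]; _∷_)
open import Data.Maybe.Relation.Unary.Any using (just) renaming (Any to MaybeAny)
open import Data.Nat
open import Data.Nat.Properties
open import Data.Product using (_×_; _,_; ∃)
open import Data.Sum using (inj₁; inj₂)
open import Data.Unit using (tt)
open import Function using (_∘_)
open import Function.Bundles using (_⇔_; mk⇔)
open import Relation.Nullary using (¬_)
open import Relation.Nullary.Decidable using (dec-true; dec-false)
open import Relation.Binary.PropositionalEquality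

-- Index a vertex (p , h) of D' by its offset l = h - p, its layer M + 1, Δ M < h ≤ Δ (M + 1), its
-- depth d = Δ (M + 1) - h in that layer, and i = M - l. In these coordinates the weights are local:
-- the horizontal edge exists iff d ≤ i, carries a_{i,d,l} and leads to (i - 1 , d , l + 1) in the
-- same layer; the diagonal edge is black and increases d while d < M, and from the bottom d = M it
-- carries e_{i,l} and leads to (i - 1 , 0 , l) in layer M. After the letter emitted at i = 0 the
-- height is the triangular number Δ l and only black horizontal edges remain, down to v_l. So the
-- path words are the words of this automaton, one letter per unit of i, and it is unambiguous
-- because an a-letter records the depth at which it was emitted. Absorbing each run of black edges
-- into the next letter turns its transitions into the conditions (i)-(iv).

private variable
  i j d l p h L M k n : ℕ
  x y : Letter
  u : Wt
  w ws : List Letter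

n≤Δn : ∀ n → n ≤ Δ n
n≤Δn zero    = z≤n
n≤Δn (suc n) = m≤m+n (suc n) (Δ n)

Δ-mono-≤ : M ≤ n → Δ M ≤ Δ n
Δ-mono-≤ z≤n       = z≤n
Δ-mono-≤ (s≤s M≤n) = +-mono-≤ (s≤s M≤n) (Δ-mono-≤ M≤n)

mutual
  ceilIdx-Δ : ∀ n → ceilIdx (Δ n) ≡ n
  ceilIdx-Δ zero    = refl
  ceilIdx-Δ (suc n) = ceilIdx-layer (m<n+m (Δ n) z<s) ≤-refl

  ceilIdx-layer : Δ M < h → h ≤ Δ (suc M) → ceilIdx h ≡ suc M
  ceilIdx-layer {M} {suc h} ΔM<h h≤ΔM+1 with m≤n⇒m<n∨m≡n (≤-pred ΔM<h)
  ... | inj₁ ΔM<h′ rewrite ceilIdx-layer {M} ΔM<h′ (<⇒≤ h≤ΔM+1)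
                         | dec-true (suc h ≤? Δ (suc M)) h≤ΔM+1 = refl
  ... | inj₂ refl  rewrite ceilIdx-Δ M
                         | dec-false (suc (Δ M) ≤? Δ M) (n≮n (Δ M)) = refl

Δ-injective : Δ M ≡ Δ n → M ≡ n
Δ-injective {M} {n} eq = trans (sym (ceilIdx-Δ M)) (trans (cong ceilIdx eq) (ceilIdx-Δ n))

record Site (i d l p h : ℕ) : Set where
  field
    depth  : d ≤ i + l
    height : h + d ≡ Δ (suc (i + l))
    offset : p + l ≡ h

record Terminal (L l p h : ℕ) : Set where
  field
    L≤l    : L ≤ l
    height : h ≡ Δ L
    offset : p + l ≡ h

data Vertex : ℕ → ℕ → ℕ → ℕ → ℕ → Set where
  terminal : Terminal l l p h → Vertex 0 0 l p h
  site     : Site i d l p h → Vertex (suc i) d l p h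

module _ (s : Site i d l p h) where
  open Site s

  site-Δ< : Δ (i + l) < h
  site-Δ< = +-cancelʳ-≤ d (suc (Δ (i + l))) h (begin
    suc (Δ (i + l)) + d       ≤⟨ +-monoʳ-≤ (suc (Δ (i + l))) depth ⟩
    suc (Δ (i + l)) + (i + l) ≡⟨ cong suc (+-comm (Δ (i + l)) (i + l)) ⟩
    Δ (suc (i + l))           ≡⟨ height ⟨
    h + d                     ∎)
    where open ≤-Reasoning

  site-ceilIdx : ceilIdx h ≡ suc (i + l)
  site-ceilIdx = ceilIdx-layer site-Δ< (≤-trans (m≤m+n h d) (≤-reflexive height))

  site-δ : δ h ≡ d
  site-δ rewrite site-ceilIdx | sym height = m+n∸m≡n h d

¬Site-0 : ¬ Site i d l 0 h
¬Site-0 {i} {d} {l} {h} s = <⇒≱ (site-Δ< s) (begin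
  h          ≡⟨ Site.offset s ⟨
  l          ≤⟨ m≤n+m l i ⟩
  i + l      ≤⟨ n≤Δn (i + l) ⟩
  Δ (i + l)  ∎)
  where open ≤-Reasoning

site-isTri : Site i (suc d) l p h → isTri h ≡ false
site-isTri {d = d} {h = h} s
  rewrite site-ceilIdx s | sym (Site.height s) = dec-false (h + suc d ≟ h) (m+1+n≢m h)

hor-target : Site i d l (suc p) h → d ≤ i → Vertex i d (suc l) p h
hor-target {zero} {l = l} {p} s z≤n = terminal record
  { L≤l = ≤-refl ; height = trans (sym (+-identityʳ _)) height ; offset = trans (+-suc p l) offset }
  where open Site s
hor-target {suc i} {d} {l} {p} s d≤i = site record
  { depth  = ≤-trans d≤i (m<m+n i z<s)
  ; height = trans height (cong (Δ ∘ suc) (sym (+-suc i l)))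
  ; offset = trans (+-suc p l) offset }
  where open Site s

black-target : Site i d l (suc p) (suc h) → d < i + l → Site i (suc d) l p h
black-target {d = d} {h = h} s d<M = record
  { depth = d<M ; height = trans (+-suc h d) height ; offset = suc-injective offset }
  where open Site s

site-bottom : Site i d l p (suc h) → d ≡ i + l → h ≡ Δ (i + l)
site-bottom {i} {l = l} {h = h} s refl =
  +-cancelʳ-≡ (i + l) h (Δ (i + l))
    (trans (suc-injective (Site.height s)) (+-comm (i + l) (Δ (i + l))))

e-target : Site i d l (suc p) (suc h) → d ≡ i + l → Vertex i 0 l p h
e-target {zero} s d≡M = terminal record
  { L≤l = ≤-refl ; height = site-bottom s d≡M ; offset = suc-injective (Site.offset s) }
e-target {suc i} s d≡M = site record
  { depth  = z≤n
  ; height = trans (+-identityʳ _) (site-bottom s d≡M)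
  ; offset = suc-injective (Site.offset s) }

terminal-target : Terminal L l (suc p) h → Terminal L (suc l) p h
terminal-target {l = l} {p} t = record
  { L≤l = m≤n⇒m≤1+n L≤l ; height = height ; offset = trans (+-suc p l) offset }
  where open Terminal t

hor-offset : suc p + l ≡ h → h ∸ p ≡ suc l
hor-offset {p} {l} refl = trans (+-∸-assoc 1 (m≤m+n p l)) (cong suc (m+n∸m≡n p l))

dia-offset : suc p + l ≡ suc h → h ∸ p ≡ l
dia-offset {p} {l} refl = m+n∸m≡n p l

-- In the weight lemmas site-δ and site-isTri must be rewritten before site-ceilIdx: the terms δ h
-- and isTri h unfold to expressions in ceilIdx h.
α-site-a : Site i d l (suc p) h → d ≤ i → α (suc p) (h ∸ p) ≡ col (a i d l)
α-site-a {i} {d} {l} {p} s d≤i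
  rewrite hor-offset {p} {l} (Site.offset s) | trans (+-suc p l) (Site.offset s)
        | site-δ s | site-ceilIdx s
        | dec-true (suc l + d ≤? suc (i + l))
            (s≤s (subst (_≤ i + l) (+-comm d l) (+-monoˡ-≤ l d≤i)))
        | m+n∸n≡m i l = refl

α-site-𝟘 : Site i d l (suc p) h → i < d → α (suc p) (h ∸ p) ≡ 𝟘
α-site-𝟘 {i} {suc d} {l} {p} s i<d
  rewrite hor-offset {p} {l} (Site.offset s) | trans (+-suc p l) (Site.offset s)
        | site-δ s | site-isTri s | site-ceilIdx s
        | dec-false (suc l + suc d ≤? suc (i + l))
            (λ le → <⇒≱ i<d (+-cancelʳ-≤ l (suc d) i
                               (subst (_≤ i + l) (+-comm l (suc d)) (≤-pred le))))
        = refl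

β-site-𝟙 : Site i d l (suc p) (suc h) → d < i + l → β (suc p) (h ∸ p) ≡ 𝟙
β-site-𝟙 {i} {d} {l} {p} {h} s d<M
  rewrite dia-offset {p} {l} (Site.offset s) | suc-injective (Site.offset s)
        | dec-true (Δ l ≤? h)
            (≤-trans (Δ-mono-≤ (m≤n+m l i)) (<⇒≤ (site-Δ< (black-target s d<M))))
        | site-isTri (black-target s d<M) = refl

β-site-e : Site i d l (suc p) (suc h) → d ≡ i + l → β (suc p) (h ∸ p) ≡ col (e i l)
β-site-e {i} {d} {l} {p} {h} s d≡M
  rewrite dia-offset {p} {l} (Site.offset s) | suc-injective (Site.offset s)
        | site-bottom s d≡M
        | dec-true (Δ l ≤? Δ (i + l)) (Δ-mono-≤ (m≤n+m l i))
        | ceilIdx-Δ (i + l) | dec-true (Δ (i + l) ≟ Δ (i + l)) refl | m+n∸n≡m i l = refl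

α-terminal-𝟙 : Terminal L l (suc p) h → α (suc p) (h ∸ p) ≡ 𝟙
α-terminal-𝟙 {L} {l} {p} t
  rewrite hor-offset {p} {l} (Terminal.offset t) | trans (+-suc p l) (Terminal.offset t)
        | Terminal.height t | ceilIdx-Δ L | n∸n≡0 (Δ L) | +-identityʳ l
        | dec-false (suc l ≤? L) (≤⇒≯ (Terminal.L≤l t))
        | dec-true (Δ L ≟ Δ L) refl
        | dec-true (Δ L <? Δ (suc l))
            (≤-<-trans (Δ-mono-≤ (Terminal.L≤l t)) (m<n+m (Δ l) z<s))
        = refl

β-terminal-𝟘 : Terminal L l (suc p) (suc h) → β (suc p) (h ∸ p) ≡ 𝟘
β-terminal-𝟘 {L} {l} {p} {h} t
  rewrite dia-offset {p} {l} (Terminal.offset t) | suc-injective (Terminal.offset t)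
        | dec-false (Δ l ≤? h)
            (<⇒≱ (≤-trans (≤-reflexive (Terminal.height t)) (Δ-mono-≤ (Terminal.L≤l t))))
        = refl

-- Accepts k (i + 1) d l holds the words of the paths from a Site i d l to v_k, and Accepts k 0 0 l
-- those from a terminal vertex at height Δ l; the constructors mirror the coloured horizontal, black
-- diagonal and coloured diagonal edges.
data Accepts (k : ℕ) : ℕ → ℕ → ℕ → List Letter → Set where
  end        : Accepts k 0 0 k []
  a-step     : d ≤ i → Accepts k i d (suc l) w → Accepts k (suc i) d l (a i d l ∷ w)
  black-step : d < i + l → Accepts k (suc i) (suc d) l w → Accepts k (suc i) d l w
  e-step     : d ≡ i + l → Accepts k i 0 l w → Accepts k (suc i) d l (e i l ∷ w)

accepts-length : Accepts k i d l w → length w ≡ i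
accepts-length end              = refl
accepts-length (a-step _ A)     = cong suc (accepts-length A)
accepts-length (black-step _ A) = accepts-length A
accepts-length (e-step _ A)     = cong suc (accepts-length A)

black-steps : d ≤′ j → j ≤ i + l → Accepts k (suc i) j l w → Accepts k (suc i) d l w
black-steps ≤′-refl          _   A = A
black-steps (≤′-step d≤′j)   j<M A = black-steps d≤′j (<⇒≤ j<M) (black-step j<M A)

-- The first letter read in Accepts k (i + 1) d l, with the black steps before it absorbed.
data Reads (k i d l : ℕ) : Letter → List Letter → Set where
  read-a : d ≤ j → j ≤ i → Accepts k i j (suc l) w → Reads k i d l (a i j l) w
  read-e : d ≤ i + l → Accepts k i 0 l w → Reads k i d l (e i l) w

read : Reads k i d l x w → Accepts k (suc i) d l (x ∷ w)
read {i = i} {l = l} (read-a d≤j j≤i A) =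
  black-steps (≤⇒≤′ d≤j) (≤-trans j≤i (m≤m+n i l)) (a-step j≤i A)
read (read-e d≤M A) = black-steps (≤⇒≤′ d≤M) ≤-refl (e-step refl A)

unread : Accepts k (suc i) d l (x ∷ w) → Reads k i d l x w
unread (a-step d≤i A)   = read-a ≤-refl d≤i A
unread (black-step _ A) with unread A
... | read-a d<j j≤i A′ = read-a (<⇒≤ d<j) j≤i A′
... | read-e d<M A′     = read-e (<⇒≤ d<M) A′
unread (e-step refl A)  = read-e ≤-refl A

¬Accepts-a-shallow : ¬ Accepts k (suc i) (suc d) l (a i d l ∷ w)
¬Accepts-a-shallow {d = d} A with unread A
... | read-a d<d _ _ = n≮n d d<d

accepts-[] : Accepts k i d l [] → i ≡ 0 × d ≡ 0 × l ≡ k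
accepts-[] end = refl , refl , refl
accepts-[] (black-step _ A) with () ← accepts-length A

After : ℕ → Letter → List Letter → Set
After k (a i j l) = Accepts k i j (suc l)
After k (e i l)   = Accepts k i 0 l

-- Validity of the letter is needed only for a → e, to descend from depth j to the bottom.
follows⇒after : ValidLetter x → Follows x y → After k y w → After k x (y ∷ w)
follows⇒after {a (suc i) j l} j≤1+i a→e A = read (read-e (≤-trans j≤1+i (m<m+n i z<s)) A)
follows⇒after _ (a→a j≤j′ j′≤i) A = read (read-a j≤j′ j′≤i A)
follows⇒after _ e→e              A = read (read-e z≤n A)
follows⇒after _ (e→a j≤i)        A = read (read-a z≤n j≤i A)

after⇒follows : After k x (y ∷ w) → Follows x y × After k y w
after⇒follows {x = a (suc i) j l} A with unread A
... | read-a j≤j′ j′≤i A′ = a→a j≤j′ j′≤i , A′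
... | read-e _ A′         = a→e , A′
after⇒follows {x = e (suc i) l} A with unread A
... | read-a _ j≤i A′ = e→a j≤i , A′
... | read-e _ A′     = e→e , A′

end⇒after : EndLetter k x → After k x []
end⇒after end-e        = end
end⇒after (end-a refl) = end

after⇒end : After k x [] → EndLetter k x
after⇒end {x = a i j l} A with accepts-[] A
... | refl , refl , refl = end-a refl
after⇒end {x = e i l} A with accepts-[] A
... | refl , _ , refl = end-e

start⇒accepts : StartLetter (suc n) x → After k x w → Accepts k (suc n) 0 0 (x ∷ w)
start⇒accepts (start-e refl)     A = read (read-e z≤n A)
start⇒accepts (start-a refl j≤n) A = read (read-a z≤n j≤n A)

accepts⇒start : Accepts k (suc n) 0 0 (x ∷ w) → StartLetter (suc n) x × After k x w
accepts⇒start A with unread A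
... | read-a _ j≤n A′ = start-a refl j≤n , A′
... | read-e _ A′     = start-e refl , A′

chain⇒after : All ValidLetter (x ∷ w) → Linked Follows (x ∷ w) →
              MaybeAny (EndLetter k) (last (x ∷ w)) → After k x w
chain⇒after {w = []}    _                 _             (just x-end) = end⇒after x-end
chain⇒after {w = _ ∷ _} (x-valid ∷ valid) (x→y ∷ chain) w-end =
  follows⇒after x-valid x→y (chain⇒after valid chain w-end)

after⇒chain : After k x w → Linked Follows (x ∷ w) × MaybeAny (EndLetter k) (last (x ∷ w))
after⇒chain {w = []}    A = [-] , just (after⇒end A)
after⇒chain {w = _ ∷ _} A with after⇒follows A
... | x→y , A′ with after⇒chain A′
...   | chain , w-end = x→y ∷ chain , w-end

accepts⇒conditions : Accepts k (suc n) 0 0 w → Conditions (suc n) k w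
accepts⇒conditions {w = []}    A with () ← accepts-length A
accepts⇒conditions {w = _ ∷ _} A with accepts⇒start A
... | x-start , A′ with after⇒chain A′
...   | chain , w-end = just x-start , w-end , chain

conditions⇒accepts : All ValidLetter w → Conditions (suc n) k w → Accepts k (suc n) 0 0 w
conditions⇒accepts {w = _ ∷ _} valid (just x-start , w-end , chain) =
  start⇒accepts x-start (chain⇒after valid chain w-end)

label-col : u ≡ col x → label u ++ ws ≡ x ∷ ws
label-col refl = refl

label-𝟙 : u ≡ 𝟙 → label u ++ ws ≡ ws
label-𝟙 refl = refl

IsEdge-col : u ≡ col x → IsEdge u
IsEdge-col refl = tt

IsEdge-𝟙 : u ≡ 𝟙 → IsEdge u
IsEdge-𝟙 refl = tt

¬IsEdge-𝟘 : u ≡ 𝟘 → ¬ IsEdge u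
¬IsEdge-𝟘 refl ()

module _ {i j i₀ j₀ : ℕ} {P Q : Path i j i₀ j₀} where

  hor-cong : {le le′ : suc i ≤ j} {ev ev′ : IsEdge (α (suc i) (j ∸ i))} →
             P ≡ Q → hor le ev P ≡ hor le′ ev′ Q
  hor-cong {le} {le′} {ev} {ev′} refl =
    cong₂ (λ le ev → hor le ev P) (≤-irrelevant le le′) (T-irrelevant ev ev′)

  dia-cong : {le le′ : i ≤ j} {ev ev′ : IsEdge (β (suc i) (j ∸ i))} →
             P ≡ Q → dia le ev P ≡ dia le′ ev′ Q
  dia-cong {le} {le′} {ev} {ev′} refl =
    cong₂ (λ le ev → dia le ev P) (≤-irrelevant le le′) (T-irrelevant ev ev′)

module _ {k : ℕ} where

  Spelled : ℕ → ℕ → List Letter → Set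
  Spelled p h w = ∃ λ (P : Path p h 0 (Δ k)) → wt P ≡ w

  terminal-wt : Terminal L l p h → (P : Path p h 0 (Δ k)) → wt P ≡ [] × L ≡ k
  terminal-wt t stop = refl , Δ-injective (sym (Terminal.height t))
  terminal-wt t (hor _ _ P) with terminal-wt (terminal-target t) P
  ... | wt≡[] , L≡k = trans (label-𝟙 (α-terminal-𝟙 t)) wt≡[] , L≡k
  terminal-wt t (dia _ ev _) = ⊥-elim (¬IsEdge-𝟘 (β-terminal-𝟘 t) ev)

  terminal-path : Terminal L l p h → L ≡ k → Spelled p h []
  terminal-path {p = zero}  record { height = refl } refl = stop , refl
  terminal-path {l = l} {p = suc p} t@record { offset = refl } refl
    with terminal-path (terminal-target t) refl
  ... | P , wt≡[] = hor (m≤m+n (suc p) l) (IsEdge-𝟙 (α-terminal-𝟙 t)) P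
                  , trans (label-𝟙 (α-terminal-𝟙 t)) wt≡[]

  terminal-unique : Terminal L l p h → (P Q : Path p h 0 (Δ k)) → P ≡ Q
  terminal-unique t stop         stop         = refl
  terminal-unique t (hor _ _ P)  (hor _ _ Q)  = hor-cong (terminal-unique (terminal-target t) P Q)
  terminal-unique t (dia _ ev _) _           = ⊥-elim (¬IsEdge-𝟘 (β-terminal-𝟘 t) ev)
  terminal-unique t (hor _ _ _) (dia _ ev _) = ⊥-elim (¬IsEdge-𝟘 (β-terminal-𝟘 t) ev)

  hor-depth : Site i d l (suc p) h → IsEdge (α (suc p) (h ∸ p)) → d ≤ i
  hor-depth s ev = ≮⇒≥ (λ i<d → ¬IsEdge-𝟘 (α-site-𝟘 s i<d) ev)

  mutual
    sound-vertex : Vertex i d l p h → (P : Path p h 0 (Δ k)) → Accepts k i d l (wt P)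
    sound-vertex (terminal t) P with terminal-wt t P
    ... | wt≡[] , refl = subst (Accepts _ 0 0 _) (sym wt≡[]) end
    sound-vertex (site s) P = sound s P

    sound : Site i d l p h → (P : Path p h 0 (Δ k)) → Accepts k (suc i) d l (wt P)
    sound s stop = ⊥-elim (¬Site-0 s)
    sound s (hor _ ev P) = subst (Accepts _ _ _ _) (sym (label-col (α-site-a s d≤i)))
                             (a-step d≤i (sound-vertex (hor-target s d≤i) P))
      where d≤i = hor-depth s ev
    sound s (dia _ _ P) with m≤n⇒m<n∨m≡n (Site.depth s)
    ... | inj₁ d<M = subst (Accepts _ _ _ _) (sym (label-𝟙 (β-site-𝟙 s d<M)))
                       (black-step d<M (sound (black-target s d<M) P))
    ... | inj₂ d≡M = subst (Accepts _ _ _ _) (sym (label-col (β-site-e s d≡M)))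
                       (e-step d≡M (sound-vertex (e-target s d≡M) P))

  mutual
    complete-vertex : Vertex i d l p h → Accepts k i d l w → Spelled p h w
    complete-vertex (terminal t) end = terminal-path t refl
    complete-vertex (site s)     A   = complete s A

    complete : Site i d l p h → Accepts k (suc i) d l w → Spelled p h w
    complete {p = zero} s _ = ⊥-elim (¬Site-0 s)
    complete {l = l} {suc p} s@record { offset = refl } (a-step d≤i A)
      with complete-vertex (hor-target s d≤i) A
    ... | P , refl = hor (s≤s (m≤m+n p l)) (IsEdge-col (α-site-a s d≤i)) P
                   , label-col (α-site-a s d≤i)
    complete {l = l} {suc p} s@record { offset = refl } (black-step d<M A)
      with complete (black-target s d<M) A
    ... | P , refl = dia (m≤m+n p l) (IsEdge-𝟙 (β-site-𝟙 s d<M)) P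
                   , label-𝟙 (β-site-𝟙 s d<M)
    complete {l = l} {suc p} s@record { offset = refl } (e-step d≡M A)
      with complete-vertex (e-target s d≡M) A
    ... | P , refl = dia (m≤m+n p l) (IsEdge-col (β-site-e s d≡M)) P
                   , label-col (β-site-e s d≡M)

  -- After a black diagonal edge the depth exceeds d, so the next a-letter cannot be a_{i,d,l}.
  hor≢dia : Site i d l (suc p) (suc h) → IsEdge (α (suc p) (suc h ∸ p)) →
            (Q : Path p h 0 (Δ k)) →
            label (α (suc p) (suc h ∸ p)) ++ ws ≢ label (β (suc p) (h ∸ p)) ++ wt Q
  hor≢dia {i} {d} {l} {ws = ws} s ev Q eq with m≤n⇒m<n∨m≡n (Site.depth s)
  ... | inj₁ d<M = ¬Accepts-a-shallow (subst (Accepts _ _ _ _) wt-Q (sound (black-target s d<M) Q))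
    where
    wt-Q : wt Q ≡ a i d l ∷ ws
    wt-Q = trans (sym (label-𝟙 (β-site-𝟙 s d<M)))
                 (trans (sym eq) (label-col (α-site-a s (hor-depth s ev))))
  ... | inj₂ d≡M
    with () ← trans (sym (label-col (α-site-a s (hor-depth s ev))))
                    (trans eq (label-col (β-site-e s d≡M)))

  mutual
    unique-vertex : Vertex i d l p h → (P Q : Path p h 0 (Δ k)) → wt P ≡ wt Q → P ≡ Q
    unique-vertex (terminal t) P Q _ = terminal-unique t P Q
    unique-vertex (site s)     P Q   = unique s P Q

    unique : Site i d l p h → (P Q : Path p h 0 (Δ k)) → wt P ≡ wt Q → P ≡ Q
    unique s stop         stop        _  = refl
    unique s (hor _ ev P) (hor _ _ Q) eq =
      hor-cong (unique-vertex (hor-target s (hor-depth s ev)) P Q (++-cancelˡ (label _) _ _ eq))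
    unique s (dia _ _ P) (dia _ _ Q) eq with m≤n⇒m<n∨m≡n (Site.depth s)
    ... | inj₁ d<M = dia-cong (unique (black-target s d<M) P Q (++-cancelˡ (label _) _ _ eq))
    ... | inj₂ d≡M = dia-cong (unique-vertex (e-target s d≡M) P Q (++-cancelˡ (label _) _ _ eq))
    unique s (hor _ ev _) (dia _ _ Q) eq = ⊥-elim (hor≢dia s ev Q eq)
    unique s (dia _ _ Q) (hor _ ev _) eq = ⊥-elim (hor≢dia s ev Q (sym eq))

source : ∀ n → Site n 0 0 (Δ (suc n)) (Δ (suc n))
source n = record
  { depth  = z≤n
  ; height = trans (+-identityʳ _) (cong (Δ ∘ suc) (sym (+-identityʳ n)))
  ; offset = +-identityʳ _ }

lemma3p3 : (n k : ℕ) → k ≤ n → 1 ≤ n → (w : List Letter) → All ValidLetter w →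
    ((∃ λ (P : 𝖯 n k) → wt P ≡ w) ⇔ Conditions n k w) ×
    ((∃ λ (P : 𝖯 n k) → wt P ≡ w) →
      length w ≡ n × ((P Q : 𝖯 n k) → wt P ≡ w → wt Q ≡ w → P ≡ Q))
lemma3p3 (suc n) k _ _ w valid =
  mk⇔ path⇒conditions conditions⇒path , λ (P , wt≡w) → length≡ P wt≡w , path-unique
  where
  path⇒conditions : Spelled {k} (Δ (suc n)) (Δ (suc n)) w → Conditions (suc n) k w
  path⇒conditions (P , wt≡w) =
    subst (Conditions (suc n) k) wt≡w (accepts⇒conditions (sound {k = k} (source n) P))

  conditions⇒path : Conditions (suc n) k w → Spelled {k} (Δ (suc n)) (Δ (suc n)) w
  conditions⇒path c = complete (source n) (conditions⇒accepts valid c)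

  length≡ : (P : 𝖯 (suc n) k) → wt P ≡ w → length w ≡ suc n
  length≡ P wt≡w = trans (cong length (sym wt≡w)) (accepts-length (sound {k = k} (source n) P))

  path-unique : (P Q : 𝖯 (suc n) k) → wt P ≡ w → wt Q ≡ w → P ≡ Q
  path-unique P Q wt≡w wt′≡w = unique {k = k} (source n) P Q (trans wt≡w (sym wt′≡w))
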